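{- Let $G_1=(V_1,E_1)$, $G_2=(V_2,E_2)$ be graphs, $k\ge1$, let $i_1,\dots,i_k\in V_1$ be pairwise distinct and $j_1,\dots,j_k\in V_2$ be pairwise distinct, and suppose $\mathfrak{s}^k_{G_1}(i_1,\dots,i_k)=\mathfrak{s}^k_{G_2}(j_1,\dots,j_k)$. Let $i\in V_1$, $j\in V_2$ be such that row $i$ of $M^k_{G_1}(i_1,\dots,i_k)$ equals row $j$ of $M^k_{G_2}(j_1,\dots,j_k)$. Then for every finite sequence $\sigma$, the number of walks in $G_1$ ending at $i$ whose pattern with respect to $(i_1,\dots,i_k)$ is $\sigma$ equals the number of walks in $G_2$ ending at $j$ whose pattern with respect to $(j_1,\dots,j_k)$ is $\sigma$.
   Context: Graphs are finite undirected graphs without multiple edges (loops permitted), with at least two nodes. $N_G(i)$ is the set of neighbours of $i$; $\{\dots\}^\#$ denotes a multiset. For pairwise distinct nodes $i_1,\dots,i_k$ of $G=(V,E)$ define labels $L_l(i)$, $i\in V$, $l\ge0$: $L_0(i)=(\emptyset,\{c(i)\})$ where $c(i)=q$ if $i=i_q$ and $c(i)=0$ otherwise; for $l\ge1$, $L_l(i)=(L_{l-1}(i),\{L_{l-1}(i'):i'\in N_G(i)\}^\#)$; labels are compared by structural equality, also across graphs. $M^k_G(i_1,\dots,i_k)$ is the matrix with rows indexed by $V$, columns by $l\ge0$, and $(i,l)$ entry $L_l(i)$; $\mathfrak{s}^k_{G_1}(i_1,\dots,i_k)=\mathfrak{s}^k_{G_2}(j_1,\dots,j_k)$ means there is a bijection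 $\pi:V_1\to V_2$ such that row $i$ of $M^k_{G_1}(i_1,\dots,i_k)$ equals row $\pi(i)$ of $M^k_{G_2}(j_1,\dots,j_k)$ for all $i\in V_1$. A walk is a sequence $(h_1,\dots,h_p)$ of nodes with $h_th_{t+1}$ an edge for each $t$; it ends at $h_p$. Its pattern with respect to $(i_1,\dots,i_k)$ is $(L_0(h_1),\dots,L_0(h_p))$, the sequence of the column-$0$ entries of $M^k_G(i_1,\dots,i_k)$ along the walk. -}

module Defs where

open import Data.Nat using (ℕ; zero; suc; _≤_; _≟_)
open import Data.Fin using (Fin)
import Data.Fin as Fin
open import Data.Fin.Properties using () renaming (_≟_ to _≟F_)
open import Data.Bool using (Bool; T)
open import Data.Bool.Properties using (T?)
open import Data.List using (List; []; _∷_; map; filter; length; last; concatMap; allFin)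
open import Data.List.Relation.Binary.Pointwise using (Pointwise; []; _∷_)
open import Data.List.Relation.Binary.Permutation.Homogeneous using (Permutation)
open import Data.Maybe using (Maybe; just; nothing)
open import Data.Maybe.Properties using () renaming (≡-dec to ≡-decM)
open import Data.Product using (Σ; _×_; _,_; ∃)
open import Relation.Binary.PropositionalEquality using (_≡_; refl)
open import Relation.Nullary using (Dec; yes; no; ¬_)
open import Relation.Nullary.Decidable using (_×-dec_)
open import Function using (_∘_)

-- Graphs: finite node set Fin n (n ≥ 2), symmetric Boolean adjacency
-- (loops allowed, no multiple edges).

record Graph : Set where
  field
    n     : ℕ
    two≤n : 2 ≤ n
    adj   : Fin n → Fin n → Bool
    sym   : ∀ i j → adj i j ≡ adj j i

open Graph public

Node : Graph → Set
Node G = Fin (n G)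

Edge : (G : Graph) → Node G → Node G → Set
Edge G i j = T (adj G i j)

neighbours : (G : Graph) → Node G → List (Node G)
neighbours G i = filter (λ j → T? (adj G i j)) (allFin (n G))

-- Labels.  leaf c  is  (∅, {c});  node L M  is  (L, M)  with the
-- multiset M represented by a list.

data Label : Set where
  leaf : ℕ → Label
  node : Label → List Label → Label

data _≈L_ : Label → Label → Set where
  leaf≈ : ∀ {c d} → c ≡ d → leaf c ≈L leaf d
  node≈ : ∀ {a b xs ys} → a ≈L b → Permutation _≈L_ xs ys → node a xs ≈L node b ys

-- Colouring c(i): q if i = i_q (1-based), 0 otherwise.  The tuple
-- (i_1,…,i_k) is a function Fin k → Node G (index q ↦ i_{q+1}).

colour : ∀ {k m} → (Fin k → Fin m) → Fin m → ℕ
colour {zero}  t i = 0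
colour {suc k} t i with t Fin.zero ≟F i
... | yes _ = 1
... | no _ with colour (t ∘ Fin.suc) i
...   | zero  = 0
...   | suc r = suc (suc r)

L : (G : Graph) → ∀ {k} → (Fin k → Node G) → ℕ → Node G → Label
L G t zero    i = leaf (colour t i)
L G t (suc l) i = node (L G t l i) (map (L G t l) (neighbours G i))

-- row i of M equals row j of M' (for all columns l ≥ 0)
SameRow : (G₁ G₂ : Graph) → ∀ {k} → (Fin k → Node G₁) → (Fin k → Node G₂)
        → Node G₁ → Node G₂ → Set
SameRow G₁ G₂ t₁ t₂ i j = ∀ l → L G₁ t₁ l i ≈L L G₂ t₂ l j

data IsWalk (G : Graph) : List (Node G) → Set where
  single : ∀ h → IsWalk G (h ∷ [])
  step   : ∀ {h h′ ws} → Edge G h h′ → IsWalk G (h′ ∷ ws) → IsWalk G (h ∷ h′ ∷ ws)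

isWalk? : (G : Graph) → (w : List (Node G)) → Dec (IsWalk G w)
isWalk? G [] = no λ ()
isWalk? G (h ∷ []) = yes (single h)
isWalk? G (h ∷ h′ ∷ ws) with T? (adj G h h′) | isWalk? G (h′ ∷ ws)
... | yes e | yes w = yes (step e w)
... | no ¬e | _     = no λ { (step e _) → ¬e e }
... | yes _ | no ¬w = no λ { (step _ w) → ¬w w }

pattern′ : (G : Graph) → ∀ {k} → (Fin k → Node G) → List (Node G) → List Label
pattern′ G t w = map (L G t 0) w

leaf≈? : (c : ℕ) (s : Label) → Dec (leaf c ≈L s)
leaf≈? c (leaf d) with c ≟ d
... | yes p = yes (leaf≈ p)
... | no ¬p = no λ { (leaf≈ p) → ¬p p }
leaf≈? c (node _ _) = no λ ()

leaves≈? : (cs : List ℕ) (σ : List Label) → Dec (Pointwise _≈L_ (map leaf cs) σ)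
leaves≈? [] [] = yes []
leaves≈? [] (_ ∷ _) = no λ ()
leaves≈? (_ ∷ _) [] = no λ ()
leaves≈? (c ∷ cs) (s ∷ σ) with leaf≈? c s | leaves≈? cs σ
... | yes p | yes q = yes (p ∷ q)
... | no ¬p | _     = no λ { (p ∷ _) → ¬p p }
... | yes _ | no ¬q = no λ { (_ ∷ q) → ¬q q }

map-map-leaf : ∀ {A : Set} (f : A → ℕ) (w : List A) → map (leaf ∘ f) w ≡ map leaf (map f w)
map-map-leaf f [] = refl
map-map-leaf f (x ∷ w) rewrite map-map-leaf f w = refl

WalkWith : (G : Graph) → ∀ {k} → (Fin k → Node G) → List Label → Node G
         → List (Node G) → Set
WalkWith G t σ i w = IsWalk G w × (last w ≡ just i) × Pointwise _≈L_ (pattern′ G t w) σ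

walkWith? : (G : Graph) → ∀ {k} (t : Fin k → Node G) (σ : List Label) (i : Node G)
          → (w : List (Node G)) → Dec (WalkWith G t σ i w)
walkWith? G t σ i w = isWalk? G w ×-dec (≡-decM _≟F_ (last w) (just i)) ×-dec pw
  where
  pw : Dec (Pointwise _≈L_ (pattern′ G t w) σ)
  pw rewrite map-map-leaf (colour t) w = leaves≈? (map (colour t) w) σ

allLists : (m p : ℕ) → List (List (Fin m))
allLists m zero    = [] ∷ []
allLists m (suc p) = concatMap (λ h → map (h ∷_) (allLists m p)) (allFin m)

-- number of walks in G ending at i whose pattern w.r.t. t is σ
-- (such walks have exactly length σ nodes)
numWalks : (G : Graph) → ∀ {k} → (Fin k → Node G) → List Label → Node G → ℕ
numWalks G t σ i = length (filter (walkWith? G t σ i) (allLists (n G) (length σ)))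

{-# OPTIONS --safe #-}
-- The label L_l(i) is the depth-l unfolding tree of the coloured graph at i.  Read backwards, a
-- walk ending at i is a walk starting at the root of this tree, so for l ≥ |σ| the number of
-- walks ending at i with pattern σ is a function of L_l(i) alone, and that
-- function respects label equality.  The counting identity behind this splits a walk at its
-- last node: the walks ending at i with pattern σ s are the walks ending at a neighbour h of i
-- with pattern σ, extended by the edge h i, provided the colour of i matches s.
module Submission where

open import Defs hiding (sym)
open import Data.Bool using (Bool; true; false; _∧_)
open import Data.Bool.Properties using (T?)
open import Data.Fin using (Fin; zero; suc)
open import Data.Fin.Properties using (_≟_)
open import Data.List using (List; []; _∷_; _∷ʳ_; _++_; map; filter; length; last; concatMap; allFin; tabulate; reverse)
open import Data.List.Properties
  using (map-∘; map-cong; map-++; map-tabulate; unfold-reverse; reverse-involutive; length-reverse)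
open import Data.List.Relation.Binary.Permutation.Homogeneous using (Permutation)
import Data.List.Relation.Binary.Permutation.Homogeneous as Homogeneous
open import Data.List.Relation.Binary.Permutation.Propositional using (↭ₛ⇒↭)
import Data.List.Relation.Binary.Permutation.Setoid.Properties as SetoidPermutation
open import Data.List.Relation.Binary.Pointwise using (Pointwise; []; _∷_; ++⁺)
open import Data.Maybe using (just)
open import Data.Maybe.Properties using (just-injective)
open import Data.Nat using (ℕ; zero; suc; _+_; _*_; _≤_; s≤s)
open import Data.Nat.ListAction using (sum)
open import Data.Nat.ListAction.Properties using (sum-++; sum-↭)
open import Data.Nat.Properties using (+-*-semiring; +-identityʳ; *-zeroʳ; *-distribˡ-+; n≤1+n)
open import Algebra.Properties.Semiring.Sum +-*-semiring
  using (sum-syntax; sum-cong-≗; ∑-comm; *-distribˡ-sum; sum-replicate-zero)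
open import Data.Product using (_×_; _,_; ∃; map₁)
open import Function using (_∘_; id; _⇔_; mk⇔)
open import Function.Bundles using (_⤖_; Bijection)
open import Function.Definitions using (Injective)
import Relation.Binary.Construct.On as On
open import Relation.Binary.PropositionalEquality
open import Relation.Nullary using (Dec; does)
open import Relation.Nullary.Decidable using (_×-dec_; does-⇔)

𝟙ᵇ : Bool → ℕ
𝟙ᵇ true  = 1
𝟙ᵇ false = 0

𝟙 : {P : Set} → Dec P → ℕ
𝟙 = 𝟙ᵇ ∘ does

𝟙-cong : {P Q : Set} → P ⇔ Q → (P? : Dec P) (Q? : Dec Q) → 𝟙 P? ≡ 𝟙 Q?
𝟙-cong P⇔Q P? Q? = cong 𝟙ᵇ (does-⇔ P⇔Q P? Q?)

𝟙ᵇ-∧ : ∀ a b → 𝟙ᵇ (a ∧ b) ≡ 𝟙ᵇ a * 𝟙ᵇ b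
𝟙ᵇ-∧ true  b = sym (+-identityʳ (𝟙ᵇ b))
𝟙ᵇ-∧ false b = refl

𝟙-× : {P Q : Set} (P? : Dec P) (Q? : Dec Q) → 𝟙 (P? ×-dec Q?) ≡ 𝟙 P? * 𝟙 Q?
𝟙-× P? Q? = 𝟙ᵇ-∧ (does P?) (does Q?)

∑-δ : ∀ {m} (i : Fin m) (f : Fin m → ℕ) → ∑[ h < m ] (𝟙 (h ≟ i) * f h) ≡ f i
∑-δ {suc m} zero    f = trans (cong₂ _+_ (+-identityʳ (f zero)) (sum-replicate-zero m)) (+-identityʳ (f zero))
∑-δ {suc m} (suc i) f = ∑-δ i (f ∘ suc)

sum-tabulate : ∀ {m} (f : Fin m → ℕ) → sum (tabulate f) ≡ ∑[ h < m ] f h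
sum-tabulate {zero}  f = refl
sum-tabulate {suc m} f = cong (f zero +_) (sum-tabulate (f ∘ suc))

sum-map-allFin : ∀ {m} (f : Fin m → ℕ) → sum (map f (allFin m)) ≡ ∑[ h < m ] f h
sum-map-allFin f = trans (cong sum (map-tabulate id f)) (sum-tabulate f)

sum-map-* : ∀ {A : Set} c (f : A → ℕ) xs → sum (map (λ x → c * f x) xs) ≡ c * sum (map f xs)
sum-map-* c f []       = sym (*-zeroʳ c)
sum-map-* c f (x ∷ xs) = trans (cong (c * f x +_) (sum-map-* c f xs)) (sym (*-distribˡ-+ c (f x) _))

sum-map-filter : ∀ {A : Set} {P : A → Set} (P? : ∀ x → Dec (P x)) (f : A → ℕ) xs →
                 sum (map f (filter P? xs)) ≡ sum (map (λ x → 𝟙 (P? x) * f x) xs)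
sum-map-filter P? f []       = refl
sum-map-filter P? f (x ∷ xs) with does (P? x)
... | true  = cong₂ _+_ (sym (+-identityʳ (f x))) (sum-map-filter P? f xs)
... | false = sum-map-filter P? f xs

length-filter≡sum : ∀ {A : Set} {P : A → Set} (P? : ∀ x → Dec (P x)) xs →
                    length (filter P? xs) ≡ sum (map (𝟙 ∘ P?) xs)
length-filter≡sum P? []       = refl
length-filter≡sum P? (x ∷ xs) with does (P? x)
... | true  = cong suc (length-filter≡sum P? xs)
... | false = length-filter≡sum P? xs

sum-map-concatMap : ∀ {A B : Set} (f : B → ℕ) (g : A → List B) xs →
                    sum (map f (concatMap g xs)) ≡ sum (map (λ x → sum (map f (g x))) xs)
sum-map-concatMap f g []       = refl
sum-map-concatMap f g (x ∷ xs) = begin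
  sum (map f (g x ++ concatMap g xs))              ≡⟨ cong sum (map-++ f (g x) (concatMap g xs)) ⟩
  sum (map f (g x) ++ map f (concatMap g xs))      ≡⟨ sum-++ (map f (g x)) _ ⟩
  sum (map f (g x)) + sum (map f (concatMap g xs)) ≡⟨ cong (sum (map f (g x)) +_) (sum-map-concatMap f g xs) ⟩
  sum (map f (g x)) + sum (map (λ y → sum (map f (g y))) xs) ∎
  where open ≡-Reasoning

sum-map-resp-Permutation : ∀ {A : Set} {R : A → A → Set} (f : A → ℕ) → (∀ {x y} → R x y → f x ≡ f y) →
                           ∀ {xs ys} → Permutation R xs ys → sum (map f xs) ≡ sum (map f ys)
sum-map-resp-Permutation f f-resp xs∼ys =
  sum-↭ (↭ₛ⇒↭ (SetoidPermutation.map⁺ (On.setoid (setoid ℕ) f) (setoid ℕ) id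
                                       (Homogeneous.map f-resp xs∼ys)))

sum-allLists-∷ : ∀ m p (f : List (Fin m) → ℕ) →
                 sum (map f (allLists m (suc p))) ≡ ∑[ h < m ] sum (map (f ∘ (h ∷_)) (allLists m p))
sum-allLists-∷ m p f = begin
  sum (map f (allLists m (suc p)))
    ≡⟨ sum-map-concatMap f _ (allFin m) ⟩
  sum (map (λ h → sum (map f (map (h ∷_) (allLists m p)))) (allFin m))
    ≡⟨ cong sum (map-cong (λ h → cong sum (sym (map-∘ (allLists m p)))) (allFin m)) ⟩
  sum (map (λ h → sum (map (f ∘ (h ∷_)) (allLists m p))) (allFin m))
    ≡⟨ sum-map-allFin {m} _ ⟩
  ∑[ h < m ] sum (map (f ∘ (h ∷_)) (allLists m p)) ∎
  where open ≡-Reasoning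

sum-allLists-∷ʳ : ∀ m p (f : List (Fin m) → ℕ) →
                  sum (map f (allLists m (suc p))) ≡ ∑[ h < m ] sum (map (λ w → f (w ∷ʳ h)) (allLists m p))
sum-allLists-∷ʳ m zero    f = sum-allLists-∷ m zero f
sum-allLists-∷ʳ m (suc p) f = begin
  sum (map f (allLists m (suc (suc p))))
    ≡⟨ sum-allLists-∷ m (suc p) f ⟩
  ∑[ h₀ < m ] sum (map (f ∘ (h₀ ∷_)) (allLists m (suc p)))
    ≡⟨ sum-cong-≗ (λ h₀ → sum-allLists-∷ʳ m p (f ∘ (h₀ ∷_))) ⟩
  ∑[ h₀ < m ] ∑[ h < m ] sum (map (λ w → f (h₀ ∷ w ∷ʳ h)) (allLists m p))
    ≡⟨ ∑-comm (λ h₀ h → sum (map (λ w → f (h₀ ∷ w ∷ʳ h)) (allLists m p))) ⟩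
  ∑[ h < m ] ∑[ h₀ < m ] sum (map (λ w → f (h₀ ∷ w ∷ʳ h)) (allLists m p))
    ≡⟨ sum-cong-≗ (λ h → sym (sum-allLists-∷ m p (λ w → f (w ∷ʳ h)))) ⟩
  ∑[ h < m ] sum (map (λ w → f (w ∷ʳ h)) (allLists m (suc p))) ∎
  where open ≡-Reasoning

last-∷ʳ : ∀ {A : Set} (xs : List A) {x} → last (xs ∷ʳ x) ≡ just x
last-∷ʳ []           = refl
last-∷ʳ (_ ∷ [])     = refl
last-∷ʳ (_ ∷ y ∷ xs) = last-∷ʳ (y ∷ xs)

Pointwise-∷ʳ⁻ : ∀ {A B : Set} {R : A → B → Set} xs ys {x y} →
                Pointwise R (xs ∷ʳ x) (ys ∷ʳ y) → Pointwise R xs ys × R x y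
Pointwise-∷ʳ⁻ []           []           (r ∷ [])  = [] , r
Pointwise-∷ʳ⁻ []           (_ ∷ [])     (_ ∷ ())
Pointwise-∷ʳ⁻ []           (_ ∷ _ ∷ _)  (_ ∷ ())
Pointwise-∷ʳ⁻ (_ ∷ [])     []           (_ ∷ ())
Pointwise-∷ʳ⁻ (_ ∷ _ ∷ _)  []           (_ ∷ ())
Pointwise-∷ʳ⁻ (_ ∷ xs)     (_ ∷ ys)     (r ∷ rs)  = map₁ (r ∷_) (Pointwise-∷ʳ⁻ xs ys rs)

module _ (G : Graph) where

  IsWalk-∷ʳ⁺ : ∀ w {h h′} → IsWalk G (w ∷ʳ h) → Edge G h h′ → IsWalk G (w ∷ʳ h ∷ʳ h′)
  IsWalk-∷ʳ⁺ []          (single _)  e = step e (single _)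
  IsWalk-∷ʳ⁺ (_ ∷ [])    (step e′ _) e = step e′ (step e (single _))
  IsWalk-∷ʳ⁺ (_ ∷ y ∷ w) (step e′ wk) e = step e′ (IsWalk-∷ʳ⁺ (y ∷ w) wk e)

  IsWalk-∷ʳ⁻ : ∀ w {h h′} → IsWalk G (w ∷ʳ h ∷ʳ h′) → IsWalk G (w ∷ʳ h) × Edge G h h′
  IsWalk-∷ʳ⁻ []          (step e _)             = single _ , e
  IsWalk-∷ʳ⁻ (_ ∷ [])    (step e′ (step e _))   = step e′ (single _) , e
  IsWalk-∷ʳ⁻ (_ ∷ y ∷ w) (step e′ wk)           = map₁ (step e′) (IsWalk-∷ʳ⁻ (y ∷ w) wk)

matches : ℕ → Label → ℕ
matches c s = 𝟙 (leaf≈? c s)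

baseColour : Label → ℕ
baseColour (leaf c)   = c
baseColour (node x _) = baseColour x

baseColour-resp : ∀ {x y} → x ≈L y → baseColour x ≡ baseColour y
baseColour-resp (leaf≈ c≡d)  = c≡d
baseColour-resp (node≈ x≈y _) = baseColour-resp x≈y

-- The number of walks with pattern τ starting at the root of the unfolding tree x.  A leaf
-- records no neighbours; the 0 returned there for |τ| ≥ 2 is never reached from L_l with |τ| ≤ l + 1.
rootedWalks : List Label → Label → ℕ
rootedWalks []           _          = 0
rootedWalks (s ∷ [])     x          = matches (baseColour x) s
rootedWalks (s ∷ _ ∷ _)  (leaf _)   = 0
rootedWalks (s ∷ s′ ∷ τ) (node x M) = matches (baseColour x) s * sum (map (rootedWalks (s′ ∷ τ)) M)

rootedWalks-resp : ∀ τ {x y} → x ≈L y → rootedWalks τ x ≡ rootedWalks τ y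
rootedWalks-resp []           _                 = refl
rootedWalks-resp (s ∷ [])     x≈y               = cong (λ c → matches c s) (baseColour-resp x≈y)
rootedWalks-resp (s ∷ _ ∷ _)  (leaf≈ _)         = refl
rootedWalks-resp (s ∷ s′ ∷ τ) (node≈ x≈y M∼M′) =
  cong₂ _*_ (cong (λ c → matches c s) (baseColour-resp x≈y))
            (sum-map-resp-Permutation (rootedWalks (s′ ∷ τ)) (rootedWalks-resp (s′ ∷ τ)) M∼M′)

module _ (G : Graph) {k} (t : Fin k → Node G) where

  private
    ws : ℕ → List (List (Node G))
    ws = allLists (n G)

  countWalks : List Label → ℕ → Node G → ℕ
  countWalks σ p i = sum (map (𝟙 ∘ walkWith? G t σ i) (ws p))

  WalkWith-∷ʳ : ∀ σ i w h → WalkWith G t σ i (w ∷ʳ h) ⇔ (h ≡ i × WalkWith G t σ h (w ∷ʳ h))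
  WalkWith-∷ʳ σ i w h = mk⇔ to from
    where
    to : WalkWith G t σ i (w ∷ʳ h) → h ≡ i × WalkWith G t σ h (w ∷ʳ h)
    to (wk , end , ps) = just-injective (trans (sym (last-∷ʳ w)) end) , wk , last-∷ʳ w , ps
    from : h ≡ i × WalkWith G t σ h (w ∷ʳ h) → WalkWith G t σ i (w ∷ʳ h)
    from (refl , walk) = walk

  WalkWith-∷ʳ-∷ʳ : ∀ σ s i w h → WalkWith G t (σ ∷ʳ s) i (w ∷ʳ h ∷ʳ i)
                   ⇔ (leaf (colour t i) ≈L s × Edge G h i × WalkWith G t σ h (w ∷ʳ h))
  WalkWith-∷ʳ-∷ʳ σ s i w h = mk⇔ to from
    where
    Split = leaf (colour t i) ≈L s × Edge G h i × WalkWith G t σ h (w ∷ʳ h)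
    MatchesPattern = λ π → Pointwise _≈L_ π (σ ∷ʳ s)
    pattern-∷ʳ : pattern′ G t (w ∷ʳ h ∷ʳ i) ≡ pattern′ G t (w ∷ʳ h) ∷ʳ leaf (colour t i)
    pattern-∷ʳ = map-++ (L G t 0) (w ∷ʳ h) (i ∷ [])
    to : WalkWith G t (σ ∷ʳ s) i (w ∷ʳ h ∷ʳ i) → Split
    to (wk , _ , ps)
      with IsWalk-∷ʳ⁻ G w wk | Pointwise-∷ʳ⁻ (pattern′ G t (w ∷ʳ h)) σ (subst MatchesPattern pattern-∷ʳ ps)
    ... | wk′ , e | ps′ , p = p , e , wk′ , last-∷ʳ w , ps′
    from : Split → WalkWith G t (σ ∷ʳ s) i (w ∷ʳ h ∷ʳ i)
    from (p , e , wk′ , _ , ps′) =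
      IsWalk-∷ʳ⁺ G w wk′ e , last-∷ʳ (w ∷ʳ h) , subst MatchesPattern (sym pattern-∷ʳ) (++⁺ ps′ (p ∷ []))

  𝟙-walkWith-∷ʳ : ∀ σ i w h →
                  𝟙 (walkWith? G t σ i (w ∷ʳ h)) ≡ 𝟙 (h ≟ i) * 𝟙 (walkWith? G t σ h (w ∷ʳ h))
  𝟙-walkWith-∷ʳ σ i w h =
    trans (𝟙-cong (WalkWith-∷ʳ σ i w h) (walkWith? G t σ i (w ∷ʳ h)) ((h ≟ i) ×-dec walk?)) (𝟙-× (h ≟ i) walk?)
    where walk? = walkWith? G t σ h (w ∷ʳ h)

  𝟙-walkWith-∷ʳ-∷ʳ : ∀ σ s i w h → 𝟙 (walkWith? G t (σ ∷ʳ s) i (w ∷ʳ h ∷ʳ i))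
                     ≡ matches (colour t i) s * (𝟙 (T? (adj G h i)) * 𝟙 (walkWith? G t σ h (w ∷ʳ h)))
  𝟙-walkWith-∷ʳ-∷ʳ σ s i w h = begin
    𝟙 step?
      ≡⟨ 𝟙-cong (WalkWith-∷ʳ-∷ʳ σ s i w h) step? (colour? ×-dec edge? ×-dec walk?) ⟩
    𝟙 (colour? ×-dec edge? ×-dec walk?) ≡⟨ 𝟙-× colour? (edge? ×-dec walk?) ⟩
    𝟙 colour? * 𝟙 (edge? ×-dec walk?)   ≡⟨ cong (𝟙 colour? *_) (𝟙-× edge? walk?) ⟩
    𝟙 colour? * (𝟙 edge? * 𝟙 walk?)     ∎
    where
    open ≡-Reasoning
    step?   = walkWith? G t (σ ∷ʳ s) i (w ∷ʳ h ∷ʳ i)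
    colour? = leaf≈? (colour t i) s
    edge?   = T? (adj G h i)
    walk?   = walkWith? G t σ h (w ∷ʳ h)

  countWalks-last : ∀ σ p i →
                    countWalks σ (suc p) i ≡ sum (map (λ w → 𝟙 (walkWith? G t σ i (w ∷ʳ i))) (ws p))
  countWalks-last σ p i = begin
    countWalks σ (suc p) i
      ≡⟨ sum-allLists-∷ʳ (n G) p _ ⟩
    ∑[ h < n G ] sum (map (λ w → 𝟙 (walkWith? G t σ i (w ∷ʳ h))) (ws p))
      ≡⟨ sum-cong-≗ (λ h → trans (cong sum (map-cong (λ w → 𝟙-walkWith-∷ʳ σ i w h) (ws p)))
                                 (sum-map-* (𝟙 (h ≟ i)) _ (ws p))) ⟩
    ∑[ h < n G ] (𝟙 (h ≟ i) * sum (map (λ w → 𝟙 (walkWith? G t σ h (w ∷ʳ h))) (ws p)))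
      ≡⟨ ∑-δ i _ ⟩
    sum (map (λ w → 𝟙 (walkWith? G t σ i (w ∷ʳ i))) (ws p)) ∎
    where open ≡-Reasoning

  countWalks-∷ʳ : ∀ σ s p i → countWalks (σ ∷ʳ s) (suc (suc p)) i
                  ≡ matches (colour t i) s * ∑[ h < n G ] (𝟙 (T? (adj G h i)) * countWalks σ (suc p) h)
  countWalks-∷ʳ σ s p i = begin
    countWalks (σ ∷ʳ s) (suc (suc p)) i
      ≡⟨ countWalks-last (σ ∷ʳ s) (suc p) i ⟩
    sum (map (λ w → 𝟙 (walkWith? G t (σ ∷ʳ s) i (w ∷ʳ i))) (ws (suc p)))
      ≡⟨ sum-allLists-∷ʳ (n G) p _ ⟩
    ∑[ h < n G ] sum (map (λ w → 𝟙 (walkWith? G t (σ ∷ʳ s) i (w ∷ʳ h ∷ʳ i))) (ws p))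
      ≡⟨ sum-cong-≗ last-step ⟩
    ∑[ h < n G ] (c * (𝟙 (T? (adj G h i)) * countWalks σ (suc p) h))
      ≡⟨ *-distribˡ-sum {n G} c _ ⟨
    c * ∑[ h < n G ] (𝟙 (T? (adj G h i)) * countWalks σ (suc p) h) ∎
    where
    open ≡-Reasoning
    c = matches (colour t i) s
    last-step : ∀ h → sum (map (λ w → 𝟙 (walkWith? G t (σ ∷ʳ s) i (w ∷ʳ h ∷ʳ i))) (ws p))
                      ≡ c * (𝟙 (T? (adj G h i)) * countWalks σ (suc p) h)
    last-step h = begin
      sum (map (λ w → 𝟙 (walkWith? G t (σ ∷ʳ s) i (w ∷ʳ h ∷ʳ i))) (ws p))
        ≡⟨ cong sum (map-cong (λ w → 𝟙-walkWith-∷ʳ-∷ʳ σ s i w h) (ws p)) ⟩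
      sum (map (λ w → c * (e * 𝟙 (walkWith? G t σ h (w ∷ʳ h)))) (ws p))
        ≡⟨ sum-map-* c _ (ws p) ⟩
      c * sum (map (λ w → e * 𝟙 (walkWith? G t σ h (w ∷ʳ h))) (ws p))
        ≡⟨ cong (c *_) (sum-map-* e _ (ws p)) ⟩
      c * (e * sum (map (λ w → 𝟙 (walkWith? G t σ h (w ∷ʳ h))) (ws p)))
        ≡⟨ cong (λ x → c * (e * x)) (countWalks-last σ p h) ⟨
      c * (e * countWalks σ (suc p) h) ∎
      where e = 𝟙 (T? (adj G h i))

  countWalks-[-] : ∀ s i → countWalks (s ∷ []) 1 i ≡ matches (colour t i) s
  countWalks-[-] s i =
    trans (countWalks-last (s ∷ []) 0 i)
          (trans (+-identityʳ _) (𝟙-cong single⇔ (walkWith? G t (s ∷ []) i (i ∷ [])) (leaf≈? (colour t i) s)))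
    where
    single⇔ : WalkWith G t (s ∷ []) i (i ∷ []) ⇔ leaf (colour t i) ≈L s
    single⇔ = mk⇔ (λ { (_ , _ , p ∷ []) → p }) (λ p → single i , refl , p ∷ [])

  baseColour-L : ∀ l i → baseColour (L G t l i) ≡ colour t i
  baseColour-L zero    i = refl
  baseColour-L (suc l) i = baseColour-L l i

  sum-map-neighbours : ∀ i (f : Node G → ℕ) →
                       sum (map f (neighbours G i)) ≡ ∑[ h < n G ] (𝟙 (T? (adj G h i)) * f h)
  sum-map-neighbours i f = begin
    sum (map f (neighbours G i))
      ≡⟨ sum-map-filter (λ h → T? (adj G i h)) f (allFin (n G)) ⟩
    sum (map (λ h → 𝟙 (T? (adj G i h)) * f h) (allFin (n G)))
      ≡⟨ sum-map-allFin {n G} _ ⟩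
    ∑[ h < n G ] (𝟙 (T? (adj G i h)) * f h)
      ≡⟨ sum-cong-≗ (λ h → cong (λ b → 𝟙 (T? b) * f h) (Graph.sym G i h)) ⟩
    ∑[ h < n G ] (𝟙 (T? (adj G h i)) * f h) ∎
    where open ≡-Reasoning

  countWalks-reverse : ∀ τ l i → length τ ≤ suc l →
                       countWalks (reverse τ) (length τ) i ≡ rootedWalks τ (L G t l i)
  countWalks-reverse []           l       i _ = refl
  countWalks-reverse (s ∷ [])     l       i _ =
    trans (countWalks-[-] s i) (cong (λ c → matches c s) (sym (baseColour-L l i)))
  countWalks-reverse (s ∷ s′ ∷ τ) zero    i (s≤s ())
  countWalks-reverse (s ∷ s′ ∷ τ) (suc l) i (s≤s τ≤l) = begin
    countWalks (reverse (s ∷ s′ ∷ τ)) (suc (suc (length τ))) i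
      ≡⟨ cong (λ σ → countWalks σ (suc (suc (length τ))) i) (unfold-reverse s (s′ ∷ τ)) ⟩
    countWalks (reverse (s′ ∷ τ) ∷ʳ s) (suc (suc (length τ))) i
      ≡⟨ countWalks-∷ʳ (reverse (s′ ∷ τ)) s (length τ) i ⟩
    matches (colour t i) s * ∑[ h < n G ] (𝟙 (T? (adj G h i)) * countWalks (reverse (s′ ∷ τ)) (suc (length τ)) h)
      ≡⟨ cong₂ _*_ (cong (λ c → matches c s) (sym (baseColour-L l i)))
                   (sum-cong-≗ (λ h → cong (𝟙 (T? (adj G h i)) *_) (countWalks-reverse (s′ ∷ τ) l h τ≤l))) ⟩
    matches (baseColour (L G t l i)) s * ∑[ h < n G ] (𝟙 (T? (adj G h i)) * rootedWalks (s′ ∷ τ) (L G t l h))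
      ≡⟨ cong (matches (baseColour (L G t l i)) s *_)
              (trans (cong sum (sym (map-∘ (neighbours G i)))) (sum-map-neighbours i _)) ⟨
    matches (baseColour (L G t l i)) s * sum (map (rootedWalks (s′ ∷ τ)) (map (L G t l) (neighbours G i))) ∎
    where open ≡-Reasoning

  numWalks≡rootedWalks : ∀ σ i → numWalks G t σ i ≡ rootedWalks (reverse σ) (L G t (length σ) i)
  numWalks≡rootedWalks σ i = begin
    numWalks G t σ i
      ≡⟨ length-filter≡sum (walkWith? G t σ i) (ws (length σ)) ⟩
    countWalks σ (length σ) i
      ≡⟨ cong₂ (λ σ′ p → countWalks σ′ p i) (reverse-involutive σ) (length-reverse σ) ⟨
    countWalks (reverse (reverse σ)) (length (reverse σ)) i
      ≡⟨ countWalks-reverse (reverse σ) (length σ) i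
           (subst (_≤ suc (length σ)) (sym (length-reverse σ)) (n≤1+n _)) ⟩
    rootedWalks (reverse σ) (L G t (length σ) i) ∎
    where open ≡-Reasoning

theorem10 : (G₁ G₂ : Graph) (k : ℕ) → 1 ≤ k
    → (t₁ : Fin k → Node G₁) → Injective _≡_ _≡_ t₁
    → (t₂ : Fin k → Node G₂) → Injective _≡_ _≡_ t₂
    → (∃ λ (π : Node G₁ ⤖ Node G₂) → ∀ i → SameRow G₁ G₂ t₁ t₂ i (Bijection.to π i))
    → (i : Node G₁) (j : Node G₂) → SameRow G₁ G₂ t₁ t₂ i j
    → (σ : List Label) → numWalks G₁ t₁ σ i ≡ numWalks G₂ t₂ σ j
theorem10 G₁ G₂ k _ t₁ _ t₂ _ _ i j sameRow σ = begin
  numWalks G₁ t₁ σ i                              ≡⟨ numWalks≡rootedWalks G₁ t₁ σ i ⟩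
  rootedWalks (reverse σ) (L G₁ t₁ (length σ) i) ≡⟨ rootedWalks-resp (reverse σ) (sameRow (length σ)) ⟩
  rootedWalks (reverse σ) (L G₂ t₂ (length σ) j) ≡⟨ numWalks≡rootedWalks G₂ t₂ σ j ⟨
  numWalks G₂ t₂ σ j                              ∎
  where open ≡-Reasoning
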